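{- Let $\mathcal{B}_{\mathcal G'}$ be the set of partitions $\lambda=(\lambda_1\ge\lambda_2\ge\cdots\ge\lambda_\ell)$ into positive parts such that $3\le\lambda_{2i-1}-\lambda_{2i}\le4$ whenever $2i\le\ell$, $\lambda_{2i}=\lambda_{2i+1}$ whenever $2i+1\le\ell$, and the smallest part $\lambda_\ell$ is $3$ or $4$ if $\ell$ is odd and equals $2$ if $\ell$ is even. For a partition let $|\lambda_o|=\lambda_1+\lambda_3+\cdots$ and $|\lambda_e|=\lambda_2+\lambda_4+\cdots$. For integers $n,h$ let $B_{G'}(n,h)=\sum x^{|\lambda_o|}y^{|\lambda_e|}$, the sum over all $\lambda\in\mathcal{B}_{\mathcal G'}$ with exactly $n$ parts and largest part $h$. Then for all integers $n\ge1$ and $h\ge0$, $$B_{G'}(2n-1,3n+h)=x^{\frac{3n^2+3n}{2}+\frac{h^2+h}{2}}y^{\frac{3n^2-3n}{2}+\frac{h^2-h}{2}}{n\brack h}_{xy},\qquad B_{G'}(2n,3n+h+2)=x^{\frac{3n^2+7n}{2}+\frac{h^2+h}{2}}y^{\frac{3n^2+n}{2}+\frac{h^2-h}{2}}{n\brack h}_{xy}.$$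
   Context: The Gaussian coefficient is ${a+b\brack b}_t=\frac{(t;t)_{a+b}}{(t;t)_a(t;t)_b}$ if $a,b\ge0$ and $0$ otherwise, with $(a;t)_n=\prod_{i=0}^{n-1}(1-at^i)$; here $t=xy$. -}

module Defs where

open import Data.Nat as ℕ using (ℕ; zero; suc; _≤_; _<_; _≤ᵇ_; _≡ᵇ_)
open import Data.Bool using (Bool; true; false; _∧_; _∨_; if_then_else_)
open import Data.List using (List; []; _∷_; map; concatMap; upTo; filter; foldr)
open import Data.Integer using (ℤ; _+_; _*_; _-_; _^_; +_; 0ℤ; 1ℤ)
open import Data.Product using (_×_)
open import Relation.Binary.PropositionalEquality using (_≡_)
open import Relation.Nullary.Decidable using ()
open import Data.Bool.Properties using (T?)
open import Data.Bool using (T)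

poch : ℤ → ℤ → ℕ → ℤ
poch a q zero    = 1ℤ
poch a q (suc n) = poch a q n * (1ℤ - a * q ^ n)

tpoch : ℤ → ℕ → ℤ
tpoch t n = poch t t n

-- All lists of length ℓ whose entries lie in {1,…,H}
-- (candidate partitions with ℓ positive parts, all parts ≤ H)
tuples : ℕ → ℕ → List (List ℕ)
tuples zero    H = [] ∷ []
tuples (suc ℓ) H = concatMap (λ a → map (a ∷_) (tuples ℓ H)) (map suc (upTo H))

gap34 : ℕ → ℕ → Bool
gap34 a b = ((b ℕ.+ 3) ≤ᵇ a) ∧ (a ≤ᵇ (b ℕ.+ 4))

-- membership in 𝓑_{𝓖'} for a list (λ₁, λ₂, …, λ_ℓ), read from λ₁ (an odd index):
--   λ_{2i-1} - λ_{2i} ∈ {3,4},  λ_{2i} = λ_{2i+1},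
--   last part ∈ {3,4} if ℓ odd, last part = 2 if ℓ even.
-- (weakly decreasing follows from these; it is also checked explicitly)
inBG' : List ℕ → Bool
inBG' []                = true
inBG' (a ∷ [])          = (a ≡ᵇ 3) ∨ (a ≡ᵇ 4)
inBG' (a ∷ b ∷ [])      = gap34 a b ∧ (b ≡ᵇ 2)
inBG' (a ∷ b ∷ c ∷ r)   = gap34 a b ∧ (b ≡ᵇ c) ∧ inBG' (c ∷ r)

decr : List ℕ → Bool
decr []          = true
decr (a ∷ [])    = true
decr (a ∷ b ∷ r) = (b ≤ᵇ a) ∧ decr (b ∷ r)

largestIs : ℕ → List ℕ → Bool
largestIs H []      = false
largestIs H (a ∷ _) = a ≡ᵇ H

mutual
  oddSum : List ℕ → ℕ
  oddSum []      = 0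
  oddSum (a ∷ r) = a ℕ.+ evenSum r

  evenSum : List ℕ → ℕ
  evenSum []      = 0
  evenSum (a ∷ r) = oddSum r

BG'set : ℕ → ℕ → List (List ℕ)
BG'set ℓ H = filter (λ l → T? (decr l ∧ inBG' l ∧ largestIs H l)) (tuples ℓ H)

BG' : ℕ → ℕ → ℤ → ℤ → ℤ
BG' ℓ H x y = foldr (λ l s → x ^ oddSum l * y ^ evenSum l + s) 0ℤ (BG'set ℓ H)

-- "L = M · [n brack h]_t", with the Gaussian coefficient
--   [n brack h]_t = (t;t)_n / ((t;t)_h (t;t)_{n-h})  if 0 ≤ h ≤ n, and 0 otherwise,
-- stated with denominators cleared.
EqTimesGauss : ℤ → ℤ → ℕ → ℕ → ℤ → Set
EqTimesGauss L M n h t =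
  (h ≤ n → L * (tpoch t h * tpoch t (n ℕ.∸ h)) ≡ M * tpoch t n)
  × (n < h → L ≡ 0ℤ)

-- Reading a partition of 𝓑_{𝓖'} from its largest part, the first two parts (a, a − 3) or (a, a − 4)
-- can be peeled off, leaving a partition of the same kind with two parts fewer and largest part a − 3 or
-- a − 4. Hence B_{G'}(ℓ + 2, a) = x^a (y^{a−3} B_{G'}(ℓ, a − 3) + y^{a−4} B_{G'}(ℓ, a − 4)); writing
-- a = 3n + c + h, this recursion in n turns into the q-Pascal recurrence
-- [n+1, h]_t = t^h [n, h]_t + [n, h−1]_t with t = xy, once the monomial of the partition with h = 0 is
-- factored out. The one- and two-part partitions (3 or 4) and (5 or 6, 2) start the induction.
module Submission where

open import Defs
open import Data.Integer using (ℤ)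

module FiniteSums where
  open import Data.Bool using (Bool; true; false; _∧_; T)
  open import Data.Bool.Properties using (T?)
  open import Data.Integer using (ℤ; _+_; _*_; 0ℤ; 1ℤ)
  open import Data.Integer.Properties
    using (+-identityˡ; +-identityʳ; +-assoc; *-identityˡ; *-zeroʳ; *-distribˡ-+; +-commutativeSemigroup)
  open import Algebra.Properties.CommutativeSemigroup +-commutativeSemigroup using (interchange)
  open import Data.List using (List; []; _∷_; _++_; map; concatMap; filter; foldr; applyUpTo)
  open import Data.Nat as ℕ using (ℕ; zero; suc; _<_; _≤_; _≡ᵇ_; z≤n; s≤s)
  open import Data.Nat.Properties using (≡ᵇ⇒≡; suc-injective; m≤n⇒m≤1+n)
  open import Relation.Nullary using (contradiction)
  open import Function using (_∘_)
  open import Relation.Binary.PropositionalEquality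
    using (_≡_; _≢_; refl; sym; trans; cong; cong₂; subst)

  private variable A B : Set

  𝟙 : Bool → ℤ
  𝟙 true  = 1ℤ
  𝟙 false = 0ℤ

  𝟙-∧ : ∀ a b → 𝟙 (a ∧ b) ≡ 𝟙 a * 𝟙 b
  𝟙-∧ true  b = sym (*-identityˡ (𝟙 b))
  𝟙-∧ false b = refl

  𝟙-≡ᵇ-≢ : ∀ {m n} → m ≢ n → 𝟙 (m ≡ᵇ n) ≡ 0ℤ
  𝟙-≡ᵇ-≢ {m} {n} m≢n with m ≡ᵇ n in eq
  ... | true  = contradiction (≡ᵇ⇒≡ m n (subst T (sym eq) _)) m≢n
  ... | false = refl

  sumOver : List A → (A → ℤ) → ℤ
  sumOver xs f = foldr (λ a s → f a + s) 0ℤ xs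

  infixr 5 sumOver sumBelow
  syntax sumOver xs (λ a → e) = ∑[ a ∈ xs ] e

  sumBelow : ℕ → (ℕ → ℤ) → ℤ
  sumBelow zero    f = 0ℤ
  sumBelow (suc n) f = f 0 + sumBelow n (f ∘ suc)

  syntax sumBelow n (λ k → e) = ∑[ k < n ] e

  sumOver-++ : (xs ys : List A) (f : A → ℤ) → sumOver (xs ++ ys) f ≡ sumOver xs f + sumOver ys f
  sumOver-++ []       ys f = sym (+-identityˡ _)
  sumOver-++ (a ∷ xs) ys f = trans (cong (f a +_) (sumOver-++ xs ys f)) (sym (+-assoc (f a) _ _))

  sumOver-concatMap : (g : A → List B) (xs : List A) (f : B → ℤ) →
    sumOver (concatMap g xs) f ≡ ∑[ a ∈ xs ] sumOver (g a) f
  sumOver-concatMap g []       f = refl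
  sumOver-concatMap g (a ∷ xs) f =
    trans (sumOver-++ (g a) (concatMap g xs) f) (cong (sumOver (g a) f +_) (sumOver-concatMap g xs f))

  sumOver-map : (g : A → B) (xs : List A) (f : B → ℤ) → sumOver (map g xs) f ≡ sumOver xs (f ∘ g)
  sumOver-map g []       f = refl
  sumOver-map g (a ∷ xs) f = cong (f (g a) +_) (sumOver-map g xs f)

  sumOver-applyUpTo : (g : ℕ → A) (n : ℕ) (f : A → ℤ) → sumOver (applyUpTo g n) f ≡ sumBelow n (f ∘ g)
  sumOver-applyUpTo g zero    f = refl
  sumOver-applyUpTo g (suc n) f = cong (f (g 0) +_) (sumOver-applyUpTo (g ∘ suc) n f)

  sumOver-cong : (xs : List A) {f g : A → ℤ} → (∀ a → f a ≡ g a) → sumOver xs f ≡ sumOver xs g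
  sumOver-cong []       f≡g = refl
  sumOver-cong (a ∷ xs) f≡g = cong₂ _+_ (f≡g a) (sumOver-cong xs f≡g)

  sumOver-*ˡ : (c : ℤ) (xs : List A) (f : A → ℤ) → ∑[ a ∈ xs ] c * f a ≡ c * sumOver xs f
  sumOver-*ˡ c []       f = sym (*-zeroʳ c)
  sumOver-*ˡ c (a ∷ xs) f = trans (cong (c * f a +_) (sumOver-*ˡ c xs f)) (sym (*-distribˡ-+ c (f a) _))

  sumOver-filter : (p : A → Bool) (xs : List A) (f : A → ℤ) →
    sumOver (filter (λ a → T? (p a)) xs) f ≡ ∑[ a ∈ xs ] 𝟙 (p a) * f a
  sumOver-filter p []       f = refl
  sumOver-filter p (a ∷ xs) f with p a
  ... | true  = cong₂ _+_ (sym (*-identityˡ (f a))) (sumOver-filter p xs f)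
  ... | false = trans (sumOver-filter p xs f) (sym (+-identityˡ _))

  sumBelow-cong : ∀ n {f g : ℕ → ℤ} → (∀ k → k < n → f k ≡ g k) → sumBelow n f ≡ sumBelow n g
  sumBelow-cong zero    f≡g = refl
  sumBelow-cong (suc n) f≡g = cong₂ _+_ (f≡g 0 (s≤s z≤n)) (sumBelow-cong n (λ k k<n → f≡g (suc k) (s≤s k<n)))

  sumBelow-vanishes : ∀ n {f : ℕ → ℤ} → (∀ k → f k ≡ 0ℤ) → sumBelow n f ≡ 0ℤ
  sumBelow-vanishes zero    f≡0 = refl
  sumBelow-vanishes (suc n) f≡0 = cong₂ _+_ (f≡0 0) (sumBelow-vanishes n (f≡0 ∘ suc))

  sumBelow-*ˡ : ∀ n (c : ℤ) (f : ℕ → ℤ) → ∑[ k < n ] c * f k ≡ c * sumBelow n f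
  sumBelow-*ˡ zero    c f = sym (*-zeroʳ c)
  sumBelow-*ˡ (suc n) c f = trans (cong (c * f 0 +_) (sumBelow-*ˡ n c (f ∘ suc))) (sym (*-distribˡ-+ c (f 0) _))

  sumBelow-+ : ∀ n (f g : ℕ → ℤ) → ∑[ k < n ] (f k + g k) ≡ sumBelow n f + sumBelow n g
  sumBelow-+ zero    f g = refl
  sumBelow-+ (suc n) f g = trans (cong (f 0 + g 0 +_) (sumBelow-+ n (f ∘ suc) (g ∘ suc))) (interchange (f 0) (g 0) _ _)

  sumBelow-single : ∀ {n u} {f : ℕ → ℤ} → u < n → (∀ k → k ≢ u → f k ≡ 0ℤ) → sumBelow n f ≡ f u
  sumBelow-single {suc n} {zero}  {f} u<n f≡0 =
    trans (cong (f 0 +_) (sumBelow-vanishes n (λ k → f≡0 (suc k) (λ ())))) (+-identityʳ (f 0))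
  sumBelow-single {suc n} {suc u} {f} (s≤s u<n) f≡0 =
    trans (cong (_+ sumBelow n (f ∘ suc)) (f≡0 0 (λ ())))
      (trans (+-identityˡ _) (sumBelow-single u<n (λ k k≢u → f≡0 (suc k) (k≢u ∘ suc-injective))))

  sumBelow-select : ∀ {n u} (f : ℕ → ℤ) → u < n → ∑[ k < n ] 𝟙 (k ≡ᵇ u) * f k ≡ f u
  sumBelow-select {u = u} f u<n =
    trans (sumBelow-single u<n (λ k k≢u → cong (_* f k) (𝟙-≡ᵇ-≢ k≢u)))
      (trans (cong (λ b → 𝟙 b * f u) (≡ᵇ-refl u)) (*-identityˡ (f u)))
    where
    ≡ᵇ-refl : ∀ u → (u ≡ᵇ u) ≡ true
    ≡ᵇ-refl zero    = refl
    ≡ᵇ-refl (suc u) = ≡ᵇ-refl u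

  -- f (v − d) if v − d is a (positive) part, and 0 otherwise.
  shiftDown : ℕ → ℕ → (ℕ → ℤ) → ℤ
  shiftDown zero    zero    f = 0ℤ
  shiftDown zero    (suc v) f = f (suc v)
  shiftDown (suc d) zero    f = 0ℤ
  shiftDown (suc d) (suc v) f = shiftDown d v f

  sumBelow-shiftDown : ∀ H d v (f : ℕ → ℤ) → v ≤ H →
    ∑[ k < H ] 𝟙 (d ℕ.+ suc k ≡ᵇ v) * f (suc k) ≡ shiftDown d v f
  sumBelow-shiftDown H zero    zero    f v≤H       = sumBelow-vanishes H (λ k → refl)
  sumBelow-shiftDown H zero    (suc v) f v≤H       = sumBelow-select (f ∘ suc) v≤H
  sumBelow-shiftDown H (suc d) zero    f v≤H       = sumBelow-vanishes H (λ k → refl)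
  sumBelow-shiftDown H (suc d) (suc v) f (s≤s v≤H) = sumBelow-shiftDown H d v f (m≤n⇒m≤1+n v≤H)

  shiftDown-vanishes : ∀ d v w {f : ℕ → ℤ} → v < d ℕ.+ w → (∀ i → i < w → f i ≡ 0ℤ) → shiftDown d v f ≡ 0ℤ
  shiftDown-vanishes zero    zero    w v<w           f≡0 = refl
  shiftDown-vanishes zero    (suc v) w v<w           f≡0 = f≡0 (suc v) v<w
  shiftDown-vanishes (suc d) zero    w v<d+w         f≡0 = refl
  shiftDown-vanishes (suc d) (suc v) w (s≤s v<d+w)   f≡0 = shiftDown-vanishes d v w v<d+w f≡0

module GaussianCoefficients where
  open import Data.Integer using (ℤ; _+_; _*_; _-_; _^_; 0ℤ; 1ℤ)
  open import Data.Integer.Properties using (*-identityˡ; *-identityʳ; *-zeroʳ; *-assoc; ^-distribˡ-+-*)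
  open import Data.Integer.Tactic.RingSolver using (solve-∀)
  open import Data.Nat as ℕ using (ℕ; zero; suc; _<_; _≤_; _∸_; s≤s)
  open import Data.Nat.Properties using (n<1+n; m<n⇒m<1+n; +-identityʳ; +-suc; m+[n∸m]≡n)
  open import Data.Product using (_,_)
  open import Relation.Binary.PropositionalEquality using (_≡_; refl; sym; trans; cong; cong₂; subst; module ≡-Reasoning)
  open ≡-Reasoning

  gaussian : ℤ → ℕ → ℕ → ℤ
  gaussian t n       zero    = 1ℤ
  gaussian t zero    (suc h) = 0ℤ
  gaussian t (suc n) (suc h) = t ^ suc h * gaussian t n (suc h) + gaussian t n h

  gaussian-vanishes : ∀ t {n h} → n < h → gaussian t n h ≡ 0ℤ
  gaussian-vanishes t {zero}  {suc h} _         = refl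
  gaussian-vanishes t {suc n} {suc h} (s≤s n<h) = begin
    t ^ suc h * gaussian t n (suc h) + gaussian t n h
      ≡⟨ cong₂ (λ a b → t ^ suc h * a + b) (gaussian-vanishes t (m<n⇒m<1+n n<h)) (gaussian-vanishes t n<h) ⟩
    t ^ suc h * 0ℤ + 0ℤ
      ≡⟨ cong (_+ 0ℤ) (*-zeroʳ (t ^ suc h)) ⟩
    0ℤ ∎

  gaussian-diagonal : ∀ t n → gaussian t n n ≡ 1ℤ
  gaussian-diagonal t zero    = refl
  gaussian-diagonal t (suc n) = begin
    t ^ suc n * gaussian t n (suc n) + gaussian t n n
      ≡⟨ cong₂ (λ a b → t ^ suc n * a + b) (gaussian-vanishes t (n<1+n n)) (gaussian-diagonal t n) ⟩
    t ^ suc n * 0ℤ + 1ℤ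
      ≡⟨ cong (_+ 1ℤ) (*-zeroʳ (t ^ suc n)) ⟩
    1ℤ ∎

  gaussian-pochhammer : ∀ t h k → gaussian t (h ℕ.+ k) h * (tpoch t h * tpoch t k) ≡ tpoch t (h ℕ.+ k)
  gaussian-pochhammer t zero    k = trans (*-identityˡ _) (*-identityˡ _)
  gaussian-pochhammer t (suc h) zero rewrite +-identityʳ h | gaussian-diagonal t (suc h) =
    trans (*-identityˡ _) (*-identityʳ _)
  gaussian-pochhammer t (suc h) (suc k) = begin
    (t ^ suc h * A + B) * (tpoch t (suc h) * tpoch t (suc k))
      ≡⟨ split t (t ^ h) (t ^ k) A B (tpoch t h) (tpoch t k) ⟩
    t ^ suc h * (1ℤ - t ^ suc k) * (A * (tpoch t (suc h) * tpoch t k)) + (1ℤ - t ^ suc h) * (B * (tpoch t h * tpoch t (suc k)))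
      ≡⟨ cong₂ (λ a b → t ^ suc h * (1ℤ - t ^ suc k) * a + (1ℤ - t ^ suc h) * b) upper lower ⟩
    t ^ suc h * (1ℤ - t ^ suc k) * tpoch t N + (1ℤ - t ^ suc h) * tpoch t N
      ≡⟨ collect (t ^ suc h) (t ^ suc k) (tpoch t N) ⟩
    tpoch t N * (1ℤ - t ^ suc h * t ^ suc k)
      ≡⟨ cong (λ p → tpoch t N * (1ℤ - p)) (sym (^-distribˡ-+-* t (suc h) (suc k))) ⟩
    tpoch t (suc N) ∎
    where
    N = h ℕ.+ suc k
    A = gaussian t N (suc h)
    B = gaussian t N h
    upper : A * (tpoch t (suc h) * tpoch t k) ≡ tpoch t N
    upper = subst (λ n → gaussian t n (suc h) * (tpoch t (suc h) * tpoch t k) ≡ tpoch t n)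
                  (sym (+-suc h k)) (gaussian-pochhammer t (suc h) k)
    lower : B * (tpoch t h * tpoch t (suc k)) ≡ tpoch t N
    lower = gaussian-pochhammer t h (suc k)
    split : ∀ t a b A B P Q →
      (t * a * A + B) * (P * (1ℤ - t * a) * (Q * (1ℤ - t * b)))
        ≡ t * a * (1ℤ - t * b) * (A * (P * (1ℤ - t * a) * Q)) + (1ℤ - t * a) * (B * (P * (Q * (1ℤ - t * b))))
    split = solve-∀
    collect : ∀ a b P → a * (1ℤ - b) * P + (1ℤ - a) * P ≡ P * (1ℤ - a * b)
    collect = solve-∀

  gaussian-pochhammer-≤ : ∀ t {n h} → h ≤ n → gaussian t n h * (tpoch t h * tpoch t (n ∸ h)) ≡ tpoch t n
  gaussian-pochhammer-≤ t {n} {h} h≤n =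
    subst (λ m → gaussian t m h * (tpoch t h * tpoch t (n ∸ h)) ≡ tpoch t m)
          (m+[n∸m]≡n h≤n) (gaussian-pochhammer t h (n ∸ h))

  gaussian⇒EqTimesGauss : ∀ {L t n h} M → L ≡ M * gaussian t n h → EqTimesGauss L M n h t
  gaussian⇒EqTimesGauss {L} {t} {n} {h} M L≡ = timesPochhammers , vanishes
    where
    timesPochhammers : h ≤ n → L * (tpoch t h * tpoch t (n ∸ h)) ≡ M * tpoch t n
    timesPochhammers h≤n = begin
      L * (tpoch t h * tpoch t (n ∸ h))                     ≡⟨ cong (_* _) L≡ ⟩
      M * gaussian t n h * (tpoch t h * tpoch t (n ∸ h))    ≡⟨ *-assoc M _ _ ⟩
      M * (gaussian t n h * (tpoch t h * tpoch t (n ∸ h)))  ≡⟨ cong (M *_) (gaussian-pochhammer-≤ t h≤n) ⟩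
      M * tpoch t n                                         ∎
    vanishes : n < h → L ≡ 0ℤ
    vanishes n<h = trans L≡ (trans (cong (M *_) (gaussian-vanishes t n<h)) (*-zeroʳ M))

module Degrees where
  open import Data.Nat using (ℕ; zero; suc; pred; _+_; _*_; _∸_; _/_)
  open import Data.Nat.DivMod using (m*n/n≡m)
  open import Data.Nat.Properties using (+-identityʳ; *-zeroʳ; *-distribʳ-+; m+n∸n≡m; +-cancelʳ-≡)
  open import Data.Nat.Tactic.RingSolver using (solve-∀)
  open import Relation.Binary.PropositionalEquality using (_≡_; refl; sym; trans; cong; module ≡-Reasoning)
  open ≡-Reasoning

  triangular : ℕ → ℕ
  triangular zero    = zero
  triangular (suc h) = suc h + triangular h

  triangular-pred : ∀ h → triangular h ≡ h + triangular (pred h)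
  triangular-pred zero    = refl
  triangular-pred (suc h) = refl

  triangular-double : ∀ h → triangular h * 2 ≡ h * h + h
  triangular-double zero    = refl
  triangular-double (suc h) = begin
    (suc h + triangular h) * 2     ≡⟨ *-distribʳ-+ 2 (suc h) (triangular h) ⟩
    suc h * 2 + triangular h * 2   ≡⟨ cong (suc h * 2 +_) (triangular-double h) ⟩
    suc h * 2 + (h * h + h)        ≡⟨ square h ⟩
    suc h * suc h + suc h          ∎
    where
    square : ∀ h → suc h * 2 + (h * h + h) ≡ suc h * suc h + suc h
    square = solve-∀

  triangular-pred-double : ∀ h → triangular (pred h) * 2 + h ≡ h * h
  triangular-pred-double zero    = refl
  triangular-pred-double (suc h) = trans (cong (_+ suc h) (triangular-double h)) (square h)
    where
    square : ∀ h → h * h + h + suc h ≡ suc h * suc h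
    square = solve-∀

  -- The x- and y-degrees of (3n+c, 3(n−1)+c, 3(n−1)+c, …, 3+c, 3+c), followed by the part c when c = 2:
  -- the only partition counted by B_{G'}(2n−1, 3n) (c = 0), resp. B_{G'}(2n, 3n+2) (c = 2).
  xDeg : ℕ → ℕ → ℕ
  xDeg c zero    = zero
  xDeg c (suc n) = suc n * 3 + c + xDeg c n

  yDeg : ℕ → ℕ → ℕ
  yDeg c zero    = zero
  yDeg c (suc n) = n * 3 + c + yDeg c n

  xDeg-double : ∀ c n → xDeg c n * 2 ≡ 3 * n * n + (3 + c * 2) * n
  xDeg-double c zero    = sym (*-zeroʳ (3 + c * 2))
  xDeg-double c (suc n) = begin
    (suc n * 3 + c + xDeg c n) * 2                        ≡⟨ *-distribʳ-+ 2 (suc n * 3 + c) (xDeg c n) ⟩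
    (suc n * 3 + c) * 2 + xDeg c n * 2                    ≡⟨ cong ((suc n * 3 + c) * 2 +_) (xDeg-double c n) ⟩
    (suc n * 3 + c) * 2 + (3 * n * n + (3 + c * 2) * n)   ≡⟨ step c n ⟩
    3 * suc n * suc n + (3 + c * 2) * suc n               ∎
    where
    step : ∀ c n → (suc n * 3 + c) * 2 + (3 * n * n + (3 + c * 2) * n) ≡ 3 * suc n * suc n + (3 + c * 2) * suc n
    step = solve-∀

  yDeg-double : ∀ c n → yDeg c n * 2 + 3 * n ≡ 3 * n * n + c * 2 * n
  yDeg-double c zero    = sym (*-zeroʳ (c * 2))
  yDeg-double c (suc n) = begin
    (n * 3 + c + yDeg c n) * 2 + 3 * suc n                  ≡⟨ step c n (yDeg c n) ⟩
    (n * 3 + c) * 2 + 3 + (yDeg c n * 2 + 3 * n)            ≡⟨ cong ((n * 3 + c) * 2 + 3 +_) (yDeg-double c n) ⟩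
    (n * 3 + c) * 2 + 3 + (3 * n * n + c * 2 * n)           ≡⟨ step′ c n ⟩
    3 * suc n * suc n + c * 2 * suc n                       ∎
    where
    step : ∀ c n Y → (n * 3 + c + Y) * 2 + 3 * suc n ≡ (n * 3 + c) * 2 + 3 + (Y * 2 + 3 * n)
    step = solve-∀
    step′ : ∀ c n → (n * 3 + c) * 2 + 3 + (3 * n * n + c * 2 * n) ≡ 3 * suc n * suc n + c * 2 * suc n
    step′ = solve-∀

  half : ∀ {a b} → a ≡ b * 2 → a / 2 ≡ b
  half {b = b} refl = m*n/n≡m b 2

  triangular-half : ∀ h → (h * h + h) / 2 ≡ triangular h
  triangular-half h = half (sym (triangular-double h))

  triangular-pred-half : ∀ h → (h * h ∸ h) / 2 ≡ triangular (pred h)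
  triangular-pred-half h =
    half (trans (cong (_∸ h) (sym (triangular-pred-double h))) (m+n∸n≡m _ h))

  xDeg-odd : ∀ n → (3 * n * n + 3 * n) / 2 ≡ xDeg 0 n
  xDeg-odd n = half (sym (xDeg-double 0 n))

  yDeg-odd : ∀ n → (3 * n * n ∸ 3 * n) / 2 ≡ yDeg 0 n
  yDeg-odd n =
    half (trans (cong (_∸ 3 * n) (trans (sym (+-identityʳ (3 * n * n))) (sym (yDeg-double 0 n)))) (m+n∸n≡m _ (3 * n)))

  xDeg-even : ∀ n → (3 * n * n + 7 * n) / 2 ≡ xDeg 2 n
  xDeg-even n = half (sym (xDeg-double 2 n))

  yDeg-even : ∀ n → (3 * n * n + n) / 2 ≡ yDeg 2 n
  yDeg-even n = half (+-cancelʳ-≡ (3 * n) (3 * n * n + n) _ (trans (same n) (sym (yDeg-double 2 n))))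
    where
    same : ∀ n → 3 * n * n + n + 3 * n ≡ 3 * n * n + 2 * 2 * n
    same = solve-∀

module Partitions (x y : ℤ) where
  open import Data.Bool using (Bool; true; false; _∧_; T)
  open import Data.Bool.Properties using (∧-assoc; ∧-zeroʳ; T-∧)
  open import Data.Empty using (⊥-elim)
  open import Data.Integer using (_+_; _*_; _^_; 0ℤ; 1ℤ)
  open import Data.Integer.Properties
    using (+-identityʳ; *-identityˡ; *-identityʳ; *-zeroʳ; ^-distribˡ-+-*; *-commutativeSemigroup)
  open import Algebra.Properties.CommutativeSemigroup *-commutativeSemigroup using (interchange; xy∙z≈y∙xz)
  open import Data.Integer.Tactic.RingSolver using (solve-∀)
  open import Data.List using (List; []; _∷_; map; upTo)
  open import Data.Nat as ℕ using (ℕ; zero; suc; pred; _<_; _≤_; _≤ᵇ_; _≡ᵇ_; z≤n; s≤s)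
  open import Data.Nat.Properties
    using (≤-refl; ≤-reflexive; <⇒≤; n<1+n; m<n⇒m<1+n; ≤ᵇ⇒≤; ≤⇒≤ᵇ; ≡ᵇ⇒≡; m+n≤o⇒m≤o; +-comm)
  import Data.Nat.Properties as ℕₚ
  import Data.Nat.Tactic.RingSolver as ℕ-Solver
  open import Data.Product using (proj₁)
  open import Function using (_∘_; id; Equivalence)
  open import Relation.Binary.PropositionalEquality using (_≡_; refl; sym; trans; cong; cong₂; module ≡-Reasoning)
  open ≡-Reasoning
  open FiniteSums
  open GaussianCoefficients
  open Degrees

  weight : List ℕ → ℤ
  weight ps = x ^ oddSum ps * y ^ evenSum ps

  admissible : List ℕ → Bool
  admissible ps = decr ps ∧ inBG' ps

  contribution : List ℕ → ℤ
  contribution ps = 𝟙 (admissible ps) * weight ps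

  tails : ℕ → ℕ → ℕ → ℤ
  tails ℓ H v = ∑[ ps ∈ tuples ℓ H ] contribution (v ∷ ps)

  sumOver-tuples : ∀ ℓ H (f : List ℕ → ℤ) → sumOver (tuples (suc ℓ) H) f ≡ ∑[ k < H ] ∑[ ps ∈ tuples ℓ H ] f (suc k ∷ ps)
  sumOver-tuples ℓ H f = begin
    sumOver (tuples (suc ℓ) H) f
      ≡⟨ sumOver-concatMap (λ a → map (a ∷_) (tuples ℓ H)) (map suc (upTo H)) f ⟩
    ∑[ a ∈ map suc (upTo H) ] sumOver (map (a ∷_) (tuples ℓ H)) f
      ≡⟨ sumOver-map suc (upTo H) (λ a → sumOver (map (a ∷_) (tuples ℓ H)) f) ⟩
    ∑[ k ∈ upTo H ] sumOver (map (suc k ∷_) (tuples ℓ H)) f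
      ≡⟨ sumOver-applyUpTo id H (λ k → sumOver (map (suc k ∷_) (tuples ℓ H)) f) ⟩
    ∑[ k < H ] sumOver (map (suc k ∷_) (tuples ℓ H)) f
      ≡⟨ sumBelow-cong H (λ k _ → sumOver-map (suc k ∷_) (tuples ℓ H) f) ⟩
    ∑[ k < H ] ∑[ ps ∈ tuples ℓ H ] f (suc k ∷ ps) ∎

  BG'≡tails : ∀ ℓ H → BG' (suc ℓ) (suc H) x y ≡ tails ℓ (suc H) (suc H)
  BG'≡tails ℓ H = begin
    BG' (suc ℓ) (suc H) x y
      ≡⟨ sumOver-filter counted (tuples (suc ℓ) (suc H)) weight ⟩
    ∑[ ps ∈ tuples (suc ℓ) (suc H) ] 𝟙 (counted ps) * weight ps
      ≡⟨ sumOver-tuples ℓ (suc H) (λ ps → 𝟙 (counted ps) * weight ps) ⟩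
    ∑[ k < suc H ] ∑[ ps ∈ tuples ℓ (suc H) ] 𝟙 (counted (suc k ∷ ps)) * weight (suc k ∷ ps)
      ≡⟨ sumBelow-cong (suc H) (λ k _ → trans (sumOver-cong (tuples ℓ (suc H)) (largest-first (suc k)))
                                              (sumOver-*ˡ (𝟙 (k ≡ᵇ H)) (tuples ℓ (suc H)) (contribution ∘ (suc k ∷_)))) ⟩
    ∑[ k < suc H ] 𝟙 (k ≡ᵇ H) * tails ℓ (suc H) (suc k)
      ≡⟨ sumBelow-select (tails ℓ (suc H) ∘ suc) (n<1+n H) ⟩
    tails ℓ (suc H) (suc H) ∎
    where
    counted : List ℕ → Bool
    counted ps = decr ps ∧ inBG' ps ∧ largestIs (suc H) ps
    largest-first : ∀ a ps → 𝟙 (counted (a ∷ ps)) * weight (a ∷ ps) ≡ 𝟙 (a ≡ᵇ suc H) * contribution (a ∷ ps)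
    largest-first a ps = begin
      𝟙 (counted (a ∷ ps)) * weight (a ∷ ps)
        ≡⟨ cong (λ b → 𝟙 b * weight (a ∷ ps)) (sym (∧-assoc (decr (a ∷ ps)) _ _)) ⟩
      𝟙 (admissible (a ∷ ps) ∧ (a ≡ᵇ suc H)) * weight (a ∷ ps)
        ≡⟨ cong (_* weight (a ∷ ps)) (𝟙-∧ (admissible (a ∷ ps)) _) ⟩
      𝟙 (admissible (a ∷ ps)) * 𝟙 (a ≡ᵇ suc H) * weight (a ∷ ps)
        ≡⟨ xy∙z≈y∙xz (𝟙 (admissible (a ∷ ps))) (𝟙 (a ≡ᵇ suc H)) (weight (a ∷ ps)) ⟩
      𝟙 (a ≡ᵇ suc H) * contribution (a ∷ ps) ∎

  ∧-drop-implied : ∀ p q D g e I → (T g → T p) → (T e → T q) → (p ∧ q ∧ D) ∧ (g ∧ e ∧ I) ≡ (g ∧ e) ∧ (D ∧ I)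
  ∧-drop-implied p     q     D false e     I _   _   = ∧-zeroʳ (p ∧ q ∧ D)
  ∧-drop-implied p     q     D true  false I _   _   = ∧-zeroʳ (p ∧ q ∧ D)
  ∧-drop-implied true  true  D true  true  I _   _   = refl
  ∧-drop-implied false q     D true  true  I g⇒p _   = ⊥-elim (g⇒p _)
  ∧-drop-implied true  false D true  true  I _   e⇒q = ⊥-elim (e⇒q _)

  gap34⇒≤ᵇ : ∀ a b → T (gap34 a b) → T (b ≤ᵇ a)
  gap34⇒≤ᵇ a b gap = ≤⇒≤ᵇ (m+n≤o⇒m≤o b (≤ᵇ⇒≤ (b ℕ.+ 3) a (proj₁ (Equivalence.to T-∧ gap))))

  𝟙-gap34 : ∀ a b → 𝟙 (gap34 a b) ≡ 𝟙 (3 ℕ.+ b ≡ᵇ a) + 𝟙 (4 ℕ.+ b ≡ᵇ a)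
  𝟙-gap34 a b rewrite +-comm b 3 | +-comm b 4 = split a b
    where
    split : ∀ a b → 𝟙 ((3 ℕ.+ b ≤ᵇ a) ∧ (a ≤ᵇ 4 ℕ.+ b)) ≡ 𝟙 (3 ℕ.+ b ≡ᵇ a) + 𝟙 (4 ℕ.+ b ≡ᵇ a)
    split 0                   zero    = refl
    split 1                   zero    = refl
    split 2                   zero    = refl
    split 3                   zero    = refl
    split 4                   zero    = refl
    split (suc (suc (suc (suc (suc a))))) zero = refl
    split zero                (suc b) = refl
    split (suc zero)          (suc b) = split zero b
    split (suc (suc a))       (suc b) = split (suc a) b

  ≡ᵇ⇒≥ᵇ : ∀ b c → T (b ≡ᵇ c) → T (c ≤ᵇ b)
  ≡ᵇ⇒≥ᵇ b c b≡c = ≤⇒≤ᵇ (≤-reflexive (sym (≡ᵇ⇒≡ b c b≡c)))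

  ≡ᵇ-sym : ∀ m n → (m ≡ᵇ n) ≡ (n ≡ᵇ m)
  ≡ᵇ-sym zero    zero    = refl
  ≡ᵇ-sym zero    (suc n) = refl
  ≡ᵇ-sym (suc m) zero    = refl
  ≡ᵇ-sym (suc m) (suc n) = ≡ᵇ-sym m n

  weight-peel : ∀ a b ps → weight (a ∷ b ∷ ps) ≡ x ^ a * y ^ b * weight ps
  weight-peel a b ps = trans (cong₂ _*_ (^-distribˡ-+-* x a (oddSum ps)) (^-distribˡ-+-* y b (evenSum ps)))
                             (interchange (x ^ a) (x ^ oddSum ps) (y ^ b) (y ^ evenSum ps))

  -- λ₂ ≤ λ₁ and λ₃ ≤ λ₂ are implied by the gap and equality conditions, so only those two survive.
  contribution-peel : ∀ a b c ps →
    contribution (a ∷ b ∷ c ∷ ps) ≡ 𝟙 (c ≡ᵇ b) * (𝟙 (gap34 a b) * (x ^ a * y ^ b) * contribution (c ∷ ps))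
  contribution-peel a b c ps = begin
    𝟙 (admissible (a ∷ b ∷ c ∷ ps)) * weight (a ∷ b ∷ c ∷ ps)
      ≡⟨ cong₂ (λ e w → 𝟙 e * w)
           (∧-drop-implied (b ≤ᵇ a) (c ≤ᵇ b) (decr (c ∷ ps)) (gap34 a b) (b ≡ᵇ c) (inBG' (c ∷ ps))
                           (gap34⇒≤ᵇ a b) (≡ᵇ⇒≥ᵇ b c))
           (weight-peel a b (c ∷ ps)) ⟩
    𝟙 ((gap34 a b ∧ (b ≡ᵇ c)) ∧ admissible (c ∷ ps)) * (x ^ a * y ^ b * weight (c ∷ ps))
      ≡⟨ cong (_* (x ^ a * y ^ b * weight (c ∷ ps)))
           (trans (𝟙-∧ (gap34 a b ∧ (b ≡ᵇ c)) _) (cong (_* 𝟙 (admissible (c ∷ ps))) (𝟙-∧ (gap34 a b) (b ≡ᵇ c)))) ⟩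
    𝟙 (gap34 a b) * 𝟙 (b ≡ᵇ c) * 𝟙 (admissible (c ∷ ps)) * (x ^ a * y ^ b * weight (c ∷ ps))
      ≡⟨ regroup (𝟙 (gap34 a b)) (𝟙 (b ≡ᵇ c)) (𝟙 (admissible (c ∷ ps))) (x ^ a * y ^ b) (weight (c ∷ ps)) ⟩
    𝟙 (b ≡ᵇ c) * (𝟙 (gap34 a b) * (x ^ a * y ^ b) * contribution (c ∷ ps))
      ≡⟨ cong (λ e → 𝟙 e * (𝟙 (gap34 a b) * (x ^ a * y ^ b) * contribution (c ∷ ps))) (≡ᵇ-sym b c) ⟩
    𝟙 (c ≡ᵇ b) * (𝟙 (gap34 a b) * (x ^ a * y ^ b) * contribution (c ∷ ps)) ∎
    where
    regroup : ∀ g e i m w → g * e * i * (m * w) ≡ e * (g * m * (i * w))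
    regroup = solve-∀

  tails-peel : ∀ ℓ H a →
    tails (2 ℕ.+ ℓ) H a ≡ ∑[ k < H ] 𝟙 (gap34 a (suc k)) * (x ^ a * y ^ suc k) * tails ℓ H (suc k)
  tails-peel ℓ H a = trans (sumOver-tuples (suc ℓ) H (contribution ∘ (a ∷_))) (sumBelow-cong H peelSecond)
    where
    peelSecond : ∀ k → k < H →
      ∑[ ps ∈ tuples (suc ℓ) H ] contribution (a ∷ suc k ∷ ps) ≡ 𝟙 (gap34 a (suc k)) * (x ^ a * y ^ suc k) * tails ℓ H (suc k)
    peelSecond k k<H = begin
      ∑[ ps ∈ tuples (suc ℓ) H ] contribution (a ∷ suc k ∷ ps)
        ≡⟨ sumOver-tuples ℓ H (contribution ∘ (a ∷_) ∘ (suc k ∷_)) ⟩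
      ∑[ j < H ] ∑[ ps ∈ tuples ℓ H ] contribution (a ∷ suc k ∷ suc j ∷ ps)
        ≡⟨ sumBelow-cong H (λ j _ → trans (sumOver-cong (tuples ℓ H) (contribution-peel a (suc k) (suc j)))
                                    (trans (sumOver-*ˡ (𝟙 (j ≡ᵇ k)) (tuples ℓ H) (λ ps → gapWeight * contribution (suc j ∷ ps)))
                                           (cong (𝟙 (j ≡ᵇ k) *_) (sumOver-*ˡ gapWeight (tuples ℓ H) (contribution ∘ (suc j ∷_)))))) ⟩
      ∑[ j < H ] 𝟙 (j ≡ᵇ k) * (gapWeight * tails ℓ H (suc j))
        ≡⟨ sumBelow-select (λ j → gapWeight * tails ℓ H (suc j)) k<H ⟩
      gapWeight * tails ℓ H (suc k) ∎
      where
      gapWeight : ℤ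
      gapWeight = 𝟙 (gap34 a (suc k)) * (x ^ a * y ^ suc k)

  addPairs : (ℕ → ℤ) → ℕ → ℕ → ℤ
  addPairs base zero    a = base a
  addPairs base (suc m) a =
    x ^ a * (shiftDown 3 a (λ b → y ^ b * addPairs base m b) + shiftDown 4 a (λ b → y ^ b * addPairs base m b))

  tails≡addPairs : ∀ {j H} (base : ℕ → ℤ) → (∀ a → tails j H a ≡ base a) →
    ∀ m a → a ≤ H → tails (m ℕ.* 2 ℕ.+ j) H a ≡ addPairs base m a
  tails≡addPairs base tails≡base zero a a≤H = tails≡base a
  tails≡addPairs {j} {H} base tails≡base (suc m) a a≤H = begin
    tails (2 ℕ.+ (m ℕ.* 2 ℕ.+ j)) H a
      ≡⟨ tails-peel (m ℕ.* 2 ℕ.+ j) H a ⟩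
    ∑[ k < H ] 𝟙 (gap34 a (suc k)) * (x ^ a * y ^ suc k) * tails (m ℕ.* 2 ℕ.+ j) H (suc k)
      ≡⟨ sumBelow-cong H rearrange ⟩
    ∑[ k < H ] x ^ a * (𝟙 (3 ℕ.+ suc k ≡ᵇ a) * f (suc k) + 𝟙 (4 ℕ.+ suc k ≡ᵇ a) * f (suc k))
      ≡⟨ sumBelow-*ˡ H (x ^ a) (λ k → 𝟙 (3 ℕ.+ suc k ≡ᵇ a) * f (suc k) + 𝟙 (4 ℕ.+ suc k ≡ᵇ a) * f (suc k)) ⟩
    x ^ a * (∑[ k < H ] 𝟙 (3 ℕ.+ suc k ≡ᵇ a) * f (suc k) + 𝟙 (4 ℕ.+ suc k ≡ᵇ a) * f (suc k))
      ≡⟨ cong (x ^ a *_) (sumBelow-+ H (λ k → 𝟙 (3 ℕ.+ suc k ≡ᵇ a) * f (suc k))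
                                       (λ k → 𝟙 (4 ℕ.+ suc k ≡ᵇ a) * f (suc k))) ⟩
    x ^ a * ((∑[ k < H ] 𝟙 (3 ℕ.+ suc k ≡ᵇ a) * f (suc k)) + (∑[ k < H ] 𝟙 (4 ℕ.+ suc k ≡ᵇ a) * f (suc k)))
      ≡⟨ cong (x ^ a *_) (cong₂ _+_ (sumBelow-shiftDown H 3 a f a≤H) (sumBelow-shiftDown H 4 a f a≤H)) ⟩
    addPairs base (suc m) a ∎
    where
    f : ℕ → ℤ
    f b = y ^ b * addPairs base m b
    distribute : ∀ p q X Y W → (p + q) * (X * Y) * W ≡ X * (p * (Y * W) + q * (Y * W))
    distribute = solve-∀
    rearrange : ∀ k → k < H →
      𝟙 (gap34 a (suc k)) * (x ^ a * y ^ suc k) * tails (m ℕ.* 2 ℕ.+ j) H (suc k)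
        ≡ x ^ a * (𝟙 (3 ℕ.+ suc k ≡ᵇ a) * f (suc k) + 𝟙 (4 ℕ.+ suc k ≡ᵇ a) * f (suc k))
    rearrange k k<H =
      trans (cong₂ (λ g t → g * (x ^ a * y ^ suc k) * t) (𝟙-gap34 a (suc k)) (tails≡addPairs base tails≡base m (suc k) k<H))
            (distribute (𝟙 (3 ℕ.+ suc k ≡ᵇ a)) (𝟙 (4 ℕ.+ suc k ≡ᵇ a)) (x ^ a) (y ^ suc k) (addPairs base m (suc k)))

  addPairs-vanishes : ∀ {c} (base : ℕ → ℤ) → (∀ a → a < 3 ℕ.+ c → base a ≡ 0ℤ) →
    ∀ m a → a < suc m ℕ.* 3 ℕ.+ c → addPairs base m a ≡ 0ℤ
  addPairs-vanishes base base≡0 zero    a a<3+c = base≡0 a a<3+c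
  addPairs-vanishes {c} base base≡0 (suc m) a a< = begin
    x ^ a * (shiftDown 3 a f + shiftDown 4 a f)
      ≡⟨ cong₂ (λ p q → x ^ a * (p + q)) (shiftDown-vanishes 3 a _ a< f≡0) (shiftDown-vanishes 4 a _ (m<n⇒m<1+n a<) f≡0) ⟩
    x ^ a * 0ℤ
      ≡⟨ *-zeroʳ (x ^ a) ⟩
    0ℤ ∎
    where
    f : ℕ → ℤ
    f b = y ^ b * addPairs base m b
    f≡0 : ∀ b → b < suc m ℕ.* 3 ℕ.+ c → f b ≡ 0ℤ
    f≡0 b b< = trans (cong (y ^ b *_) (addPairs-vanishes base base≡0 m b b<)) (*-zeroʳ (y ^ b))

  mono : ℕ → ℕ → ℤ
  mono a b = x ^ a * y ^ b

  mono-* : ∀ a b c d → mono a b * mono c d ≡ mono (a ℕ.+ c) (b ℕ.+ d)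
  mono-* a b c d =
    trans (interchange (x ^ a) (y ^ b) (x ^ c) (y ^ d))
          (sym (cong₂ _*_ (^-distribˡ-+-* x a c) (^-distribˡ-+-* y b d)))

  mono-diagonal : ∀ k → (x * y) ^ k ≡ mono k k
  mono-diagonal zero    = refl
  mono-diagonal (suc k) = trans (cong (x * y *_) (mono-diagonal k)) (interchange x y (x ^ k) (y ^ k))

  mono-shift : ∀ a b k → mono (a ℕ.+ k) (b ℕ.+ k) ≡ mono a b * (x * y) ^ k
  mono-shift a b k = trans (sym (mono-* a b k k)) (cong (mono a b *_) (sym (mono-diagonal k)))

  closedForm : ℕ → ℕ → ℕ → ℤ
  closedForm c n h = mono (xDeg c n ℕ.+ triangular h) (yDeg c n ℕ.+ triangular (pred h)) * gaussian (x * y) n h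

  closedForm-vanishes : ∀ c {n h} → n < h → closedForm c n h ≡ 0ℤ
  closedForm-vanishes c {n} {h} n<h = trans (cong (M *_) (gaussian-vanishes (x * y) n<h)) (*-zeroʳ M)
    where
    M = mono (xDeg c n ℕ.+ triangular h) (yDeg c n ℕ.+ triangular (pred h))

  addPairs-closed : ∀ {c} (base : ℕ → ℤ) →
    (∀ a → a < 3 ℕ.+ c → base a ≡ 0ℤ) → (∀ h → base (3 ℕ.+ (c ℕ.+ h)) ≡ closedForm c 1 h) →
    ∀ m h → addPairs base m (suc m ℕ.* 3 ℕ.+ (c ℕ.+ h)) ≡ closedForm c (suc m) h
  addPairs-closed base base≡0 base≡ zero h = base≡ h
  addPairs-closed {c} base base≡0 base≡ (suc m) zero = begin
    x ^ a * (y ^ a₃ * addPairs base m a₃ + y ^ a₄ * addPairs base m a₄)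
      ≡⟨ cong₂ (λ p q → x ^ a * (y ^ a₃ * p + y ^ a₄ * q))
               (addPairs-closed base base≡0 base≡ m zero)
               (addPairs-vanishes base base≡0 m a₄ (≤-reflexive (cong (λ d → 3 ℕ.+ m ℕ.* 3 ℕ.+ d) (ℕₚ.+-identityʳ c)))) ⟩
    x ^ a * (y ^ a₃ * (mono A B * 1ℤ) + y ^ a₄ * 0ℤ)
      ≡⟨ regroup (x ^ a) (y ^ a₃) (y ^ a₄) (mono A B) ⟩
    mono a a₃ * mono A B * 1ℤ
      ≡⟨ cong (_* 1ℤ) (trans (mono-* a a₃ A B) (cong₂ mono (xExp m c (xDeg c (suc m))) (yExp m c (yDeg c (suc m))))) ⟩
    closedForm c (suc (suc m)) zero ∎
    where
    a  = suc (suc m) ℕ.* 3 ℕ.+ (c ℕ.+ 0)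
    a₃ = suc m ℕ.* 3 ℕ.+ (c ℕ.+ 0)
    a₄ = suc (suc (m ℕ.* 3 ℕ.+ (c ℕ.+ 0)))
    A  = xDeg c (suc m) ℕ.+ 0
    B  = yDeg c (suc m) ℕ.+ 0
    regroup : ∀ X Y₃ Y₄ M → X * (Y₃ * (M * 1ℤ) + Y₄ * 0ℤ) ≡ X * Y₃ * M * 1ℤ
    regroup = solve-∀
    xExp : ∀ m c X → suc (suc m) ℕ.* 3 ℕ.+ (c ℕ.+ 0) ℕ.+ (X ℕ.+ 0) ≡ suc (suc m) ℕ.* 3 ℕ.+ c ℕ.+ X ℕ.+ 0
    xExp = ℕ-Solver.solve-∀
    yExp : ∀ m c Y → suc m ℕ.* 3 ℕ.+ (c ℕ.+ 0) ℕ.+ (Y ℕ.+ 0) ≡ suc m ℕ.* 3 ℕ.+ c ℕ.+ Y ℕ.+ 0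
    yExp = ℕ-Solver.solve-∀
  addPairs-closed {c} base base≡0 base≡ (suc m) (suc h) = begin
    x ^ a * (y ^ a₃ * addPairs base m a₃ + y ^ a₄ * addPairs base m a₄)
      ≡⟨ cong₂ (λ p q → x ^ a * (y ^ a₃ * p + y ^ a₄ * q))
               (addPairs-closed base base≡0 base≡ m (suc h))
               (trans (cong (addPairs base m) (a₄≡ m c h)) (addPairs-closed base base≡0 base≡ m h)) ⟩
    x ^ a * (y ^ a₃ * (mono A₁ B₁ * g₁) + y ^ a₄ * (mono A₂ B₂ * g₂))
      ≡⟨ regroup (x ^ a) (y ^ a₃) (y ^ a₄) (mono A₁ B₁) (mono A₂ B₂) g₁ g₂ ⟩
    mono a a₃ * mono A₁ B₁ * g₁ + mono a a₄ * mono A₂ B₂ * g₂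
      ≡⟨ cong₂ (λ p q → p * g₁ + q * g₂) (mono-* a a₃ A₁ B₁) (mono-* a a₄ A₂ B₂) ⟩
    mono (a ℕ.+ A₁) (a₃ ℕ.+ B₁) * g₁ + mono (a ℕ.+ A₂) (a₄ ℕ.+ B₂) * g₂
      ≡⟨ cong₂ (λ p q → p * g₁ + q * g₂) (cong₂ mono x₁ y₁) (cong₂ mono x₂ y₂) ⟩
    mono (A ℕ.+ suc h) (B ℕ.+ suc h) * g₁ + mono A B * g₂
      ≡⟨ cong (λ p → p * g₁ + mono A B * g₂) (mono-shift A B (suc h)) ⟩
    mono A B * (x * y) ^ suc h * g₁ + mono A B * g₂
      ≡⟨ factor (mono A B) ((x * y) ^ suc h) g₁ g₂ ⟩
    closedForm c (suc (suc m)) (suc h) ∎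
    where
    a  = suc (suc m) ℕ.* 3 ℕ.+ (c ℕ.+ suc h)
    a₃ = suc m ℕ.* 3 ℕ.+ (c ℕ.+ suc h)
    a₄ = suc (suc (m ℕ.* 3 ℕ.+ (c ℕ.+ suc h)))
    X  = xDeg c (suc m)
    Y  = yDeg c (suc m)
    A  = xDeg c (suc (suc m)) ℕ.+ triangular (suc h)
    B  = yDeg c (suc (suc m)) ℕ.+ triangular h
    A₁ = X ℕ.+ triangular (suc h)
    B₁ = Y ℕ.+ triangular h
    A₂ = X ℕ.+ triangular h
    B₂ = Y ℕ.+ triangular (pred h)
    g₁ = gaussian (x * y) (suc m) (suc h)
    g₂ = gaussian (x * y) (suc m) h
    a₄≡ : ∀ m c h → suc (suc (m ℕ.* 3 ℕ.+ (c ℕ.+ suc h))) ≡ suc m ℕ.* 3 ℕ.+ (c ℕ.+ h)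
    a₄≡ = ℕ-Solver.solve-∀
    regroup : ∀ P Q₃ Q₄ M₁ M₂ g₁ g₂ → P * (Q₃ * (M₁ * g₁) + Q₄ * (M₂ * g₂)) ≡ P * Q₃ * M₁ * g₁ + P * Q₄ * M₂ * g₂
    regroup = solve-∀
    factor : ∀ M T g₁ g₂ → M * T * g₁ + M * g₂ ≡ M * (T * g₁ + g₂)
    factor = solve-∀
    x₁ : a ℕ.+ A₁ ≡ A ℕ.+ suc h
    x₁ = xExp₁ m c h X (triangular (suc h))
      where
      xExp₁ : ∀ m c h X T → suc (suc m) ℕ.* 3 ℕ.+ (c ℕ.+ suc h) ℕ.+ (X ℕ.+ T) ≡ suc (suc m) ℕ.* 3 ℕ.+ c ℕ.+ X ℕ.+ T ℕ.+ suc h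
      xExp₁ = ℕ-Solver.solve-∀
    y₁ : a₃ ℕ.+ B₁ ≡ B ℕ.+ suc h
    y₁ = yExp₁ m c h Y (triangular h)
      where
      yExp₁ : ∀ m c h Y T → suc m ℕ.* 3 ℕ.+ (c ℕ.+ suc h) ℕ.+ (Y ℕ.+ T) ≡ suc m ℕ.* 3 ℕ.+ c ℕ.+ Y ℕ.+ T ℕ.+ suc h
      yExp₁ = ℕ-Solver.solve-∀
    x₂ : a ℕ.+ A₂ ≡ A
    x₂ = xExp₂ m c h X (triangular h)
      where
      xExp₂ : ∀ m c h X T → suc (suc m) ℕ.* 3 ℕ.+ (c ℕ.+ suc h) ℕ.+ (X ℕ.+ T) ≡ suc (suc m) ℕ.* 3 ℕ.+ c ℕ.+ X ℕ.+ (suc h ℕ.+ T)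
      xExp₂ = ℕ-Solver.solve-∀
    y₂ : a₄ ℕ.+ B₂ ≡ B
    y₂ = trans (yExp₂ m c h Y (triangular (pred h))) (cong (suc m ℕ.* 3 ℕ.+ c ℕ.+ Y ℕ.+_) (sym (triangular-pred h)))
      where
      yExp₂ : ∀ m c h Y P → suc (suc (m ℕ.* 3 ℕ.+ (c ℕ.+ suc h))) ℕ.+ (Y ℕ.+ P) ≡ suc m ℕ.* 3 ℕ.+ c ℕ.+ Y ℕ.+ (h ℕ.+ P)
      yExp₂ = ℕ-Solver.solve-∀

  BG'-closedForm : ∀ j c (base : ℕ → ℤ) →
    (∀ {H} → 3 ≤ H → ∀ a → tails j H a ≡ base a) →
    (∀ a → a < 3 ℕ.+ c → base a ≡ 0ℤ) → (∀ h → base (3 ℕ.+ (c ℕ.+ h)) ≡ closedForm c 1 h) →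
    ∀ m h → BG' (suc (m ℕ.* 2 ℕ.+ j)) (suc m ℕ.* 3 ℕ.+ (c ℕ.+ h)) x y ≡ closedForm c (suc m) h
  BG'-closedForm j c base tails≡base base≡0 base≡ m h = begin
    BG' (suc (m ℕ.* 2 ℕ.+ j)) (suc H) x y      ≡⟨ BG'≡tails (m ℕ.* 2 ℕ.+ j) H ⟩
    tails (m ℕ.* 2 ℕ.+ j) (suc H) (suc H)     ≡⟨ tails≡addPairs base (tails≡base (s≤s (s≤s (s≤s z≤n)))) m (suc H) ≤-refl ⟩
    addPairs base m (suc H)                   ≡⟨ addPairs-closed base base≡0 base≡ m h ⟩
    closedForm c (suc m) h                    ∎
    where
    H = suc (suc (m ℕ.* 3 ℕ.+ (c ℕ.+ h)))

  𝟙-∧-false : ∀ p g → 𝟙 (p ∧ (g ∧ false)) ≡ 0ℤ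
  𝟙-∧-false p g = cong 𝟙 (trans (cong (p ∧_) (∧-zeroʳ g)) (∧-zeroʳ p))

  tails-two-parts : ∀ {H} → 2 ≤ H → ∀ a → tails 1 H a ≡ contribution (a ∷ 2 ∷ [])
  tails-two-parts {H} 2≤H a = begin
    tails 1 H a
      ≡⟨ sumOver-tuples 0 H (contribution ∘ (a ∷_)) ⟩
    ∑[ k < H ] (contribution (a ∷ suc k ∷ []) + 0ℤ)
      ≡⟨ sumBelow-cong H (λ k _ → lastPart k) ⟩
    ∑[ k < H ] 𝟙 (k ≡ᵇ 1) * contribution (a ∷ 2 ∷ [])
      ≡⟨ sumBelow-select (λ _ → contribution (a ∷ 2 ∷ [])) 2≤H ⟩
    contribution (a ∷ 2 ∷ []) ∎
    where
    lastPart : ∀ k → contribution (a ∷ suc k ∷ []) + 0ℤ ≡ 𝟙 (k ≡ᵇ 1) * contribution (a ∷ 2 ∷ [])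
    lastPart zero          =
      trans (+-identityʳ _) (cong (_* weight (a ∷ 1 ∷ [])) (𝟙-∧-false ((1 ≤ᵇ a) ∧ true) (gap34 a 1)))
    lastPart (suc zero)    = trans (+-identityʳ _) (sym (*-identityˡ _))
    lastPart (suc (suc k)) =
      trans (+-identityʳ _) (cong (_* weight (a ∷ 3 ℕ.+ k ∷ [])) (𝟙-∧-false ((3 ℕ.+ k ≤ᵇ a) ∧ true) (gap34 a (3 ℕ.+ k))))

  BG'-odd : ∀ m h → BG' (suc (m ℕ.* 2 ℕ.+ 0)) (suc m ℕ.* 3 ℕ.+ (0 ℕ.+ h)) x y ≡ closedForm 0 (suc m) h
  BG'-odd = BG'-closedForm 0 0 (λ a → contribution (a ∷ [])) (λ _ a → +-identityʳ _) below start
    where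
    below : ∀ a → a < 3 → contribution (a ∷ []) ≡ 0ℤ
    below 0 _ = refl
    below 1 _ = refl
    below 2 _ = refl
    below (suc (suc (suc a))) (s≤s (s≤s (s≤s ())))
    start : ∀ h → contribution (3 ℕ.+ h ∷ []) ≡ closedForm 0 1 h
    start 0             = trans (*-identityˡ _) (sym (*-identityʳ _))
    start 1             = trans (*-identityˡ _) (sym (trans (cong (mono 4 0 *_) (gaussian-diagonal (x * y) 1)) (*-identityʳ _)))
    start (suc (suc h)) = sym (closedForm-vanishes 0 {1} {suc (suc h)} (s≤s (s≤s z≤n)))

  BG'-even : ∀ m h → BG' (suc (m ℕ.* 2 ℕ.+ 1)) (suc m ℕ.* 3 ℕ.+ (2 ℕ.+ h)) x y ≡ closedForm 2 (suc m) h
  BG'-even = BG'-closedForm 1 2 (λ a → contribution (a ∷ 2 ∷ [])) (λ 3≤H → tails-two-parts (<⇒≤ 3≤H)) below start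
    where
    below : ∀ a → a < 5 → contribution (a ∷ 2 ∷ []) ≡ 0ℤ
    below 0 _ = refl
    below 1 _ = refl
    below 2 _ = refl
    below 3 _ = refl
    below 4 _ = refl
    below (suc (suc (suc (suc (suc a))))) (s≤s (s≤s (s≤s (s≤s (s≤s ())))))
    start : ∀ h → contribution (5 ℕ.+ h ∷ 2 ∷ []) ≡ closedForm 2 1 h
    start 0             = trans (*-identityˡ _) (sym (*-identityʳ _))
    start 1             = trans (*-identityˡ _) (sym (trans (cong (mono 6 2 *_) (gaussian-diagonal (x * y) 1)) (*-identityʳ _)))
    start (suc (suc h)) = sym (closedForm-vanishes 2 {1} {suc (suc h)} (s≤s (s≤s z≤n)))

open import Data.Nat using (ℕ; suc; _≤_; _+_; _*_; _∸_; _/_)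
open import Data.Integer using (ℤ) renaming (_*_ to _*ℤ_; _^_ to _^ℤ_)
open import Data.Product using (_×_; _,_)
open import Data.Nat.Tactic.RingSolver using (solve-∀)
open import Relation.Binary.PropositionalEquality using (_≡_; cong₂; sym; trans)
open GaussianCoefficients using (gaussian; gaussian⇒EqTimesGauss)
open Degrees

theorem5p8 : (n h : ℕ) → 1 ≤ n → (x y : ℤ) →
  EqTimesGauss (BG' (2 * n ∸ 1) (3 * n + h) x y)
    ((x ^ℤ ((3 * n * n + 3 * n) / 2 + (h * h + h) / 2)) *ℤ (y ^ℤ ((3 * n * n ∸ 3 * n) / 2 + (h * h ∸ h) / 2)))
    n h (x *ℤ y)
  ×
  EqTimesGauss (BG' (2 * n) (3 * n + h + 2) x y)
    ((x ^ℤ ((3 * n * n + 7 * n) / 2 + (h * h + h) / 2)) *ℤ (y ^ℤ ((3 * n * n + n) / 2 + (h * h ∸ h) / 2)))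
    n h (x *ℤ y)
theorem5p8 (suc m) h _ x y = gaussian⇒EqTimesGauss Modd odd , gaussian⇒EqTimesGauss Meven even
  where
  n = suc m
  Modd  = x ^ℤ ((3 * n * n + 3 * n) / 2 + (h * h + h) / 2) *ℤ y ^ℤ ((3 * n * n ∸ 3 * n) / 2 + (h * h ∸ h) / 2)
  Meven = x ^ℤ ((3 * n * n + 7 * n) / 2 + (h * h + h) / 2) *ℤ y ^ℤ ((3 * n * n + n) / 2 + (h * h ∸ h) / 2)
  monomial : ∀ {a a′ b b′} → a ≡ a′ → b ≡ b′ →
    x ^ℤ a *ℤ y ^ℤ b *ℤ gaussian (x *ℤ y) n h ≡ x ^ℤ a′ *ℤ y ^ℤ b′ *ℤ gaussian (x *ℤ y) n h
  monomial = cong₂ (λ a b → x ^ℤ a *ℤ y ^ℤ b *ℤ gaussian (x *ℤ y) n h)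
  oddParts : ∀ m → m + (suc m + 0) ≡ suc (m * 2 + 0)
  oddParts = solve-∀
  oddLargest : ∀ m h → 3 * suc m + h ≡ suc m * 3 + (0 + h)
  oddLargest = solve-∀
  evenParts : ∀ m → 2 * suc m ≡ suc (m * 2 + 1)
  evenParts = solve-∀
  evenLargest : ∀ m h → 3 * suc m + h + 2 ≡ suc m * 3 + (2 + h)
  evenLargest = solve-∀
  odd : BG' (2 * n ∸ 1) (3 * n + h) x y ≡ Modd *ℤ gaussian (x *ℤ y) n h
  odd = trans (cong₂ (λ ℓ H → BG' ℓ H x y) (oddParts m) (oddLargest m h))
          (trans (Partitions.BG'-odd x y m h)
                 (monomial (sym (cong₂ _+_ (xDeg-odd n) (triangular-half h))) (sym (cong₂ _+_ (yDeg-odd n) (triangular-pred-half h)))))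
  even : BG' (2 * n) (3 * n + h + 2) x y ≡ Meven *ℤ gaussian (x *ℤ y) n h
  even = trans (cong₂ (λ ℓ H → BG' ℓ H x y) (evenParts m) (evenLargest m h))
           (trans (Partitions.BG'-even x y m h)
                  (monomial (sym (cong₂ _+_ (xDeg-even n) (triangular-half h))) (sym (cong₂ _+_ (yDeg-even n) (triangular-pred-half h)))))
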